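{- Let $\mathbf{A}=\{(a,b)\mid a,b\in\mathbb{Z}_{\geq 1}\}$. For $(a,b),(a',b')\in\mathbf{A}$ write $(a,b)\succ\succ(a',b')$ if $(a',b')$ is one of $(a+1,b)$, $(a,b-1)$, or $(na,nb)$ for some $n\in\mathbb{Z}_{\geq1}$; write $(a,b)\succ(a',b')$ if there is a finite sequence $(a,b)=(a_0,b_0)\succ\succ(a_1,b_1)\succ\succ\cdots\succ\succ(a_n,b_n)=(a',b')$ with $n\geq 0$. Then $\succ$ is a partial order on $\mathbf{A}$, and for every real $r>0$ the subset $\mathbf{A}_r=\{(a,b)\in\mathbf{A}\mid b/a>r\}$ is directed for $\succ$: for any $(a,b),(a',b')\in\mathbf{A}_r$ there exists $(a'',b'')\in\mathbf{A}_r$ with $(a,b)\succ(a'',b'')$ and $(a',b')\succ(a'',b'')$. -}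

module Defs where

open import Level using (0ℓ)
open import Data.Nat using (ℕ; suc; _*_; _≤_; NonZero)
open import Data.Integer using (+_)
open import Data.Rational using (ℚ; _/_; _<_; 0ℚ)
open import Data.Product using (Σ; ∃; ∃-syntax; _×_; _,_; proj₁; proj₂)
open import Data.Sum using (_⊎_)
open import Relation.Nullary using (¬_)
open import Relation.Binary.Construct.Closure.ReflexiveTransitive using (Star)

Pos : ℕ × ℕ → Set
Pos (a , b) = NonZero a × NonZero b

𝐀 : Set
𝐀 = Σ (ℕ × ℕ) Pos

data Step : ℕ × ℕ → ℕ × ℕ → Set where
  incA  : ∀ {a b} → Step (a , b) (suc a , b)
  decB  : ∀ {a b} → Step (a , suc b) (a , b)
  scale : ∀ {a b} (n : ℕ) → 1 ≤ n → Step (a , b) (n * a , n * b)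

_≻≻_ : 𝐀 → 𝐀 → Set
x ≻≻ y = Step (proj₁ x) (proj₁ y)

_≻_ : 𝐀 → 𝐀 → Set
_≻_ = Star _≻≻_

record ℝ : Set₁ where
  field
    L U        : ℚ → Set
    inhabitedL : ∃[ q ] L q
    inhabitedU : ∃[ q ] U q
    lowerL     : ∀ {p q} → p < q → L q → L p
    upperU     : ∀ {p q} → p < q → U p → U q
    roundedL   : ∀ {q} → L q → ∃[ p ] (q < p × L p)
    roundedU   : ∀ {q} → U q → ∃[ p ] (p < q × U p)
    disjoint   : ∀ {q} → ¬ (L q × U q)
    located    : ∀ {p q} → p < q → L p ⊎ U q

Positive : ℝ → Set
Positive r = ℝ.L r 0ℚ

_<ℝℚ_ : ℝ → ℚ → Set
r <ℝℚ q = ℝ.U r q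

ratio : 𝐀 → ℚ
ratio ((a , b) , (nza , nzb)) = _/_ (+ b) a {{nza}}

In𝐀 : ℝ → 𝐀 → Set
In𝐀 r x = r <ℝℚ ratio x

module Submission where

-- For antisymmetry we find two quantities
-- that are monotone along every elementary move, hence (by folding over the
-- chain) along ≻: the denominator never decreases, and the fraction b/a
-- never increases (expressed by cross-multiplication in ℕ).  If x ≻ y ≻ x
-- then x and y have the same denominator and the same fraction, hence the
-- same numerator; equality in 𝐀 is equality of the underlying pairs since
-- NonZero proofs are unique.
--
-- The set 𝐀_r only depends on the fraction b/a, so we show
-- more generally that every fibre-closed set {x | P (b/a)} is directed.  If
-- b/a ≤ b'/a' then z = a'·(a , b) = (a'a , a'b) works: x ≻ z by one scaling
-- move, z has the same fraction as x, and y ≻ z by scaling with a to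
-- (aa' , ab') followed by lowering the numerator from ab' to a'b.

open import Defs
open import Data.Product using (∃-syntax; _×_; _,_; proj₁; proj₂)
open import Relation.Binary.PropositionalEquality using (_≡_)
open import Relation.Binary.Structures using (IsPartialOrder)

open import Data.Nat using (ℕ; suc; _*_; _≤_; _≤′_; ≤′-refl; ≤′-step; NonZero; >-nonZero; >-nonZero⁻¹)
open import Data.Nat.Properties
open import Algebra.Properties.CommutativeSemigroup *-commutativeSemigroup using (xy∙z≈xz∙y; xy∙z≈y∙xz)
open import Data.Sum using (inj₁; inj₂)
open import Relation.Binary.PropositionalEquality using (refl; sym; trans; cong; cong₂; subst; isEquivalence)
open import Relation.Binary.Construct.Closure.ReflexiveTransitive using (ε; _◅_; _◅◅_; fold)
open import Data.Integer using (+_)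
open import Data.Integer.Properties using (pos-*)
open import Data.Rational using (ℚ)
open import Data.Rational.Unnormalised using (mkℚᵘ; *≡*)
open import Data.Rational.Properties using (fromℚᵘ-cong)

den num : 𝐀 → ℕ
den x = proj₁ (proj₁ x)
num x = proj₂ (proj₁ x)

NonZero-irrelevant : ∀ {n} (p q : NonZero n) → p ≡ q
NonZero-irrelevant {suc n} _ _ = refl

𝐀-≡ : {x y : 𝐀} → proj₁ x ≡ proj₁ y → x ≡ y
𝐀-≡ {_ , (pa , pb)} {_ , (qa , qb)} refl =
  cong₂ (λ p q → (_ , (p , q))) (NonZero-irrelevant pa qa) (NonZero-irrelevant pb qb)

cross-trans : ∀ {a b a' b' a'' b''} .{{_ : NonZero a'}} →
  b' * a ≤ b * a' → b'' * a' ≤ b' * a'' → b'' * a ≤ b * a''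
cross-trans {a} {b} {a'} {b'} {a''} {b''} h₁ h₂ = *-cancelʳ-≤ (b'' * a) (b * a'') a' (begin
  b'' * a * a'   ≡⟨ xy∙z≈xz∙y b'' a a' ⟩
  b'' * a' * a   ≤⟨ *-monoˡ-≤ a h₂ ⟩
  b' * a'' * a   ≡⟨ xy∙z≈xz∙y b' a'' a ⟩
  b' * a * a''   ≤⟨ *-monoˡ-≤ a'' h₁ ⟩
  b * a' * a''   ≡⟨ xy∙z≈xz∙y b a' a'' ⟩
  b * a'' * a'   ∎)
  where open ≤-Reasoning

_≤ᵈ_ : 𝐀 → 𝐀 → Set
x ≤ᵈ y = den x ≤ den y

den-step : ∀ {x y} → x ≻≻ y → x ≤ᵈ y
den-step {(a , _) , _} incA          = n≤1+n a
den-step                decB          = ≤-refl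
den-step {(a , _) , _} (scale n 1≤n) = m≤n*m a n {{>-nonZero 1≤n}}

den-mono : ∀ {x y} → x ≻ y → x ≤ᵈ y
den-mono = fold _≤ᵈ_ (λ {x} {y} s le → ≤-trans (den-step {x} {y} s) le) ≤-refl

_≥ʳ_ : 𝐀 → 𝐀 → Set
x ≥ʳ y = num y * den x ≤ num x * den y

≥ʳ-trans : ∀ {x y z} → x ≥ʳ y → y ≥ʳ z → x ≥ʳ z
≥ʳ-trans {(a , b) , _} {(a' , b') , (pa' , _)} {(a'' , b'') , _} =
  cross-trans {a} {b} {a'} {b'} {a''} {b''} {{pa'}}

ratio-step : ∀ {x y} → x ≻≻ y → x ≥ʳ y
ratio-step {(a , b) , _}     incA      = *-monoʳ-≤ b (n≤1+n a)
ratio-step {(a , suc b) , _} decB      = *-monoˡ-≤ a (n≤1+n b)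
ratio-step {(a , b) , _}     (scale n _) = ≤-reflexive (xy∙z≈y∙xz n b a)

ratio-mono : ∀ {x y} → x ≻ y → x ≥ʳ y
ratio-mono = fold _≥ʳ_ (λ {x} {y} {z} s ge → ≥ʳ-trans {x} {y} {z} (ratio-step {x} {y} s) ge) ≤-refl

≻-antisym : ∀ {x y} → x ≻ y → y ≻ x → x ≡ y
≻-antisym {(a , b) , (pa , _)} {(a' , b') , _} x≻y y≻x
  with ≤-antisym (den-mono x≻y) (den-mono y≻x)
... | refl = 𝐀-≡ (cong (a ,_) (sym (same-numerator (ratio-mono x≻y) (ratio-mono y≻x))))
  where
  same-numerator : b' * a ≤ b * a → b * a ≤ b' * a → b' ≡ b
  same-numerator le ge = ≤-antisym (*-cancelʳ-≤ b' b a {{pa}} le) (*-cancelʳ-≤ b b' a {{pa}} ge)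

≻-isPartialOrder : IsPartialOrder _≡_ _≻_
≻-isPartialOrder = record
  { isPreorder = record
    { isEquivalence = isEquivalence
    ; reflexive     = λ { refl → ε }
    ; trans         = _◅◅_
    }
  ; antisym = ≻-antisym
  }

ratio-cong : ∀ {x y} → num x * den y ≡ num y * den x → ratio x ≡ ratio y
ratio-cong {(suc a , b) , _} {(suc a' , b') , _} e =
  fromℚᵘ-cong {mkℚᵘ (+ b) a} {mkℚᵘ (+ b') a'}
    (*≡* (trans (sym (pos-* b (suc a'))) (trans (cong +_ e) (pos-* b' (suc a)))))

infixr 30 _·_
_·_ : (n : ℕ) → .{{NonZero n}} → 𝐀 → 𝐀
_·_ n {{pn}} ((a , b) , (pa , pb)) = (n * a , n * b) , (m*n≢0 n a {{pn}} {{pa}} , m*n≢0 n b {{pn}} {{pb}})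

scale-≻ : ∀ n .{{_ : NonZero n}} x → x ≻ n · x
scale-≻ n _ = scale n (>-nonZero⁻¹ n) ◅ ε

ratio-· : ∀ n .{{_ : NonZero n}} x → ratio (n · x) ≡ ratio x
ratio-· n x@((a , b) , _) = ratio-cong {n · x} {x} (xy∙z≈y∙xz n b a)

lower : ∀ {a b c} {pa : NonZero a} {pb : NonZero b} {pc : NonZero c} →
  c ≤′ b → ((a , b) , (pa , pb)) ≻ ((a , c) , (pa , pc))
lower {pb = pb} {pc} ≤′-refl rewrite NonZero-irrelevant pb pc = ε
lower {pc = pc} (≤′-step c≤′b) =
  decB ◅ lower {pb = >-nonZero (<-≤-trans (>-nonZero⁻¹ _ {{pc}}) (≤′⇒≤ c≤′b))} c≤′b

descend : ∀ x y → den x ≡ den y → num y ≤ num x → x ≻ y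
descend ((a , b) , (pa , pb)) ((a , c) , (qa , pc)) refl c≤b
  rewrite NonZero-irrelevant pa qa = lower (≤⇒≤′ c≤b)

below-both : ∀ x y → den y * num x ≤ den x * num y →
  ∃[ z ] (ratio z ≡ ratio x × x ≻ z × y ≻ z)
below-both x@((a , _) , (pa , _)) y@((a' , _) , (pa' , _)) le =
  a' · x , ratio-· a' x , scale-≻ a' x ,
  (scale-≻ a y ◅◅ descend (a · y) (a' · x) (*-comm a a') le)
  where instance _ = pa ; _ = pa'

ratio-set-directed : (P : ℚ → Set) → ∀ x y → P (ratio x) → P (ratio y) →
  ∃[ z ] (P (ratio z) × x ≻ z × y ≻ z)
ratio-set-directed P x y Px Py with ≤-total (den y * num x) (den x * num y)
... | inj₁ le with below-both x y le
...   | z , eq , x≻z , y≻z = z , subst P (sym eq) Px , x≻z , y≻z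
ratio-set-directed P x y Px Py | inj₂ ge with below-both y x ge
...   | z , eq , y≻z , x≻z = z , subst P (sym eq) Py , x≻z , y≻z

-- 𝐀_r is the set cut out by r < b/a.
lemma1p13 : IsPartialOrder _≡_ _≻_
    × (∀ (r : ℝ) → Positive r → ∀ (x y : 𝐀) → In𝐀 r x → In𝐀 r y
    → ∃[ z ] (In𝐀 r z × x ≻ z × y ≻ z))
lemma1p13 = ≻-isPartialOrder , λ r _ → ratio-set-directed (r <ℝℚ_)
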